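{- For $n\geqslant1$ let $P_n(x)=\sum_{\pi\in\mathfrak{S}_n}x^{\mathrm{pk}(\pi)}$ be the peak polynomial. Then for every $n\geqslant1$, $$xP_{2n-1}(x)=\sum_{j=1}^{n}2^{2n-2j}(2j-1)!\,U(n,j)\,x^j(1-x)^{n-j},$$ $$xP_{2n}(x)=\sum_{j=1}^{n}2^{2n-2j}(2j)!\,U(n,j)\,x^j(1-x)^{n-j}.$$
   Context: $\mathfrak{S}_n$ is the symmetric group on $[n]=\{1,\ldots,n\}$. For $\pi=\pi(1)\cdots\pi(n)\in\mathfrak{S}_n$, an interior peak is an index $i\in\{2,\ldots,n-1\}$ with $\pi(i-1)<\pi(i)>\pi(i+1)$, and $\mathrm{pk}(\pi)$ is the number of interior peaks. The central factorial numbers of even indices $U(n,k)$ ($n\geqslant1$) are defined by $U(1,1)=1$, $U(1,k)=0$ for $k\neq1$, and $U(n,k)=U(n-1,k-1)+k^2U(n-1,k)$. -}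

module Defs where

open import Data.Nat as ℕ using (ℕ; zero; suc; _<ᵇ_; _≡ᵇ_)
open import Data.Integer as ℤ using (ℤ; +_; _*_; _+_; _-_; _^_)
open import Data.Fin using (Fin; toℕ)
open import Data.Fin.Properties using (_≟_)
open import Data.List using (List; []; _∷_; map; concatMap; filter; allFin)
open import Data.Bool using (Bool; true; false; if_then_else_; _∧_)
import Data.List.Relation.Unary.Unique.DecPropositional as UD

words : (m k : ℕ) → List (List (Fin m))
words m zero    = [] ∷ []
words m (suc k) = concatMap (λ a → map (a ∷_) (words m k)) (allFin m)

-- 𝔖_n : permutations of [n] in one-line notation = words of length n
-- over Fin n with pairwise distinct letters (Fin n stands for {1,…,n}, order-preserving)

perms : (n : ℕ) → List (List (Fin n))
perms n = filter (UD.unique? (_≟_ {n})) (words n n)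

pk : {n : ℕ} → List (Fin n) → ℕ
pk (a ∷ b ∷ c ∷ rest) =
  (if (toℕ a <ᵇ toℕ b) ∧ (toℕ c <ᵇ toℕ b) then 1 else 0) ℕ.+ pk (b ∷ c ∷ rest)
pk _ = 0

sumℤ : List ℤ → ℤ
sumℤ []       = + 0
sumℤ (x ∷ xs) = x + sumℤ xs

P : ℕ → ℤ → ℤ
P n x = sumℤ (map (λ π → x ^ pk π) (perms n))

sum1to : ℕ → (ℕ → ℤ) → ℤ
sum1to zero    f = + 0
sum1to (suc n) f = sum1to n f + f (suc n)

-- central factorial numbers U(n,k), n ≥ 1 (U 0 k unused, set to 0)
U : ℕ → ℕ → ℕ
U zero k = 0
U (suc zero) k = if k ≡ᵇ 1 then 1 else 0
U (suc (suc n)) zero = 0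
U (suc (suc n)) (suc k) = U (suc n) k ℕ.+ (suc k ℕ.* suc k) ℕ.* U (suc n) (suc k)

-- Inserting the maximum into one of the n + 1 slots of a permutation σ of [n] with k peaks keeps k
-- peaks in 2k + 2 slots (the two ends and the two sides of each peak) and creates one more peak in
-- the other n − 1 − 2k. Hence Aₙ = x Pₙ satisfies Aₙ₊₁ = (n + 1) x Aₙ + 2x(1 − x) Aₙ′. On xʲ(1 − x)ᵉ this
-- operator gives (L − 2e) xʲ⁺¹(1 − x)ᵉ + 2j xʲ(1 − x)ᵉ⁺¹ with L = n + 1: for L = 2(j + e) it multiplies
-- xʲ(1 − x)ᵉ by 2j, and for L = 2(j + e) + 1 it yields (2j + 1) xʲ⁺¹(1 − x)ᵉ + 2j xʲ(1 − x)ᵉ⁺¹. Starting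
-- from A₁ = x, both expansions follow by a joint induction, the coefficients obeying the recurrence
-- U(n, k) = U(n − 1, k − 1) + k² U(n − 1, k).

module Submission where

open import Defs
open import Data.Nat as ℕ using (ℕ; zero; suc; _≤_; _<_; _∸_; _!; _<ᵇ_; z≤n; s≤s)
import Data.Nat.Properties as ℕP
import Data.Nat.Tactic.RingSolver as ℕ-Solver
open import Data.Integer using (ℤ; +_; _+_; _-_; _*_; _^_; -1ℤ)
import Data.Integer.Properties as ℤP
open import Data.Integer.Tactic.RingSolver using (solve-∀)
open import Data.Bool using (Bool; true; false; if_then_else_; _∧_)
import Data.Bool.Properties as BoolP
open import Data.Fin using (Fin; fromℕ; inject₁; toℕ)
open import Data.Fin.Properties using (_≟_; fromℕ≢inject₁; inject₁-injective; toℕ-fromℕ; toℕ-inject₁; toℕ<n)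
open import Data.Fin.Relation.Unary.Top using (view; ‵fromℕ; ‵inject₁)
open import Data.List using (List; []; _∷_; map; concatMap; _++_; length; filter; allFin)
import Data.List.Properties as LP
open import Data.List.Relation.Unary.All as All using (All; []; _∷_)
import Data.List.Relation.Unary.All.Properties as AllP
import Data.List.Relation.Unary.AllPairs as AllPairs
import Data.List.Relation.Unary.AllPairs.Properties as AllPairsP
open import Data.List.Relation.Unary.Any as Any using (here; there)
open import Data.List.Relation.Unary.Unique.Propositional using (Unique; []; _∷_)
import Data.List.Relation.Unary.Unique.Propositional.Properties as UniqueP
import Data.List.Relation.Unary.Unique.DecPropositional as UniqueDec
open import Data.List.Membership.Propositional using (_∈_; _∉_)
open import Data.List.Membership.Propositional.Properties
  using (∈-∃++; ∈-++⁺ˡ; ∈-++⁺ʳ; ∈-map⁺; ∈-map⁻; ∈-concat⁺′; ∈-concat⁻′; ∈-filter⁺; ∈-filter⁻; ∈-allFin)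
open import Data.List.Membership.Propositional.Properties.WithK using (unique∧set⇒bag)
open import Data.List.Relation.Binary.BagAndSetEquality using (∼bag⇒↭)
open import Data.List.Relation.Binary.Permutation.Propositional as ↭ using (_↭_; ↭⇒↭ₛ)
import Data.List.Relation.Binary.Permutation.Propositional.Properties as ↭P
open import Data.List.Relation.Binary.Permutation.Setoid.Properties using (Unique-resp-↭)
open import Data.Product using (_×_; _,_; proj₁; ∃; ∃₂)
open import Data.Sum using (inj₁; inj₂)
open import Function using (_∘_; mk⇔)
open import Relation.Nullary using (¬_; yes; no; contradiction)
open import Relation.Nullary.Decidable using (¬?)
open import Relation.Binary.Definitions using (DecidableEquality)
open import Relation.Binary.PropositionalEquality
  using (_≡_; _≢_; _≗_; refl; sym; trans; cong; cong₂; subst; setoid; module ≡-Reasoning)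

sumℤ-++ : (xs ys : List ℤ) → sumℤ (xs ++ ys) ≡ sumℤ xs + sumℤ ys
sumℤ-++ []       ys = sym (ℤP.+-identityˡ _)
sumℤ-++ (x ∷ xs) ys = trans (cong (_+_ x) (sumℤ-++ xs ys)) (sym (ℤP.+-assoc x _ _))

sumℤ-map-* : ∀ {A : Set} (c : ℤ) (f : A → ℤ) (xs : List A) →
  sumℤ (map (λ a → c * f a) xs) ≡ c * sumℤ (map f xs)
sumℤ-map-* c f []       = sym (ℤP.*-zeroʳ c)
sumℤ-map-* c f (a ∷ xs) = trans (cong (_+_ (c * f a)) (sumℤ-map-* c f xs)) (sym (ℤP.*-distribˡ-+ c (f a) _))

sumℤ-map-∘ : ∀ {A B : Set} (f : B → ℤ) (g : A → B) (xs : List A) →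
  sumℤ (map f (map g xs)) ≡ sumℤ (map (f ∘ g) xs)
sumℤ-map-∘ f g xs = cong sumℤ (sym (LP.map-∘ xs))

sumℤ-concatMap : ∀ {A B : Set} (g : B → ℤ) (f : A → List B) (xs : List A) →
  sumℤ (map g (concatMap f xs)) ≡ sumℤ (map (λ a → sumℤ (map g (f a))) xs)
sumℤ-concatMap g f []       = refl
sumℤ-concatMap g f (a ∷ xs) = begin
  sumℤ (map g (f a ++ concatMap f xs))                ≡⟨ cong sumℤ (LP.map-++ g (f a) _) ⟩
  sumℤ (map g (f a) ++ map g (concatMap f xs))        ≡⟨ sumℤ-++ (map g (f a)) _ ⟩
  sumℤ (map g (f a)) + sumℤ (map g (concatMap f xs))  ≡⟨ cong (_+_ (sumℤ (map g (f a)))) (sumℤ-concatMap g f xs) ⟩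
  _                                                   ∎
  where open ≡-Reasoning

sumℤ-↭ : {xs ys : List ℤ} → xs ↭ ys → sumℤ xs ≡ sumℤ ys
sumℤ-↭ ↭.refl                       = refl
sumℤ-↭ (↭.prep x p)                 = cong (_+_ x) (sumℤ-↭ p)
sumℤ-↭ (↭.swap {ys = ys} x y p)     = trans (cong (λ t → x + (y + t)) (sumℤ-↭ p)) (+-exchange x y (sumℤ ys))
  where
  +-exchange : ∀ a b c → a + (b + c) ≡ b + (a + c)
  +-exchange = solve-∀
sumℤ-↭ (↭.trans p q)                = trans (sumℤ-↭ p) (sumℤ-↭ q)

sum1to-cong : ∀ n {f g : ℕ → ℤ} → (∀ j → j < n → f (suc j) ≡ g (suc j)) → sum1to n f ≡ sum1to n g
sum1to-cong zero    _  = refl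
sum1to-cong (suc n) eq = cong₂ _+_ (sum1to-cong n (λ j j<n → eq j (ℕP.m<n⇒m<1+n j<n))) (eq n ℕP.≤-refl)

sum1to-+ : ∀ n (f g : ℕ → ℤ) → sum1to n (λ j → f j + g j) ≡ sum1to n f + sum1to n g
sum1to-+ zero    f g = refl
sum1to-+ (suc n) f g =
  trans (cong (_+ (f (suc n) + g (suc n))) (sum1to-+ n f g)) (interchange (sum1to n f) (sum1to n g) _ _)
  where
  interchange : ∀ a b c d → a + b + (c + d) ≡ a + c + (b + d)
  interchange = solve-∀

sum1to-shift : ∀ n (f : ℕ → ℤ) → sum1to (suc n) f ≡ f 1 + sum1to n (f ∘ suc)
sum1to-shift zero    f = ℤP.+-comm (+ 0) (f 1)
sum1to-shift (suc n) f = trans (cong (_+ f (suc (suc n))) (sum1to-shift n f)) (ℤP.+-assoc (f 1) _ _)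

sum1to-drop-last : ∀ n (f : ℕ → ℤ) → f (suc n) ≡ + 0 → sum1to (suc n) f ≡ sum1to n f
sum1to-drop-last n f fₙ₊₁≡0 = trans (cong (_+_ (sum1to n f)) fₙ₊₁≡0) (ℤP.+-identityʳ _)

sum1to-drop-first : ∀ n (f : ℕ → ℤ) → f 1 ≡ + 0 → sum1to (suc n) f ≡ sum1to n (f ∘ suc)
sum1to-drop-first n f f₁≡0 = trans (sum1to-shift n f) (trans (cong (_+ sum1to n (f ∘ suc)) f₁≡0) (ℤP.+-identityˡ _))

-- Permutations as insertions of the maximum

Unique-concatMap : ∀ {A B : Set} {f : A → List B} {xs : List A} → (∀ x → Unique (f x)) →
  (∀ {x y v} → v ∈ f x → v ∈ f y → x ≡ y) → Unique xs → Unique (concatMap f xs)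
Unique-concatMap {xs = xs} uf common u = UniqueP.concat⁺
  (AllP.map⁺ (All.universal uf xs))
  (AllPairsP.map⁺ (AllPairs.map (λ x≢y {_} (p , q) → x≢y (common p q)) u))

Unique-shift : ∀ {A : Set} {x : A} u v → Unique (u ++ x ∷ v) → Unique (x ∷ u ++ v)
Unique-shift {x = x} u v = Unique-resp-↭ (setoid _) (↭⇒↭ₛ (↭P.shift x u v))

Unique-unshift : ∀ {A : Set} {x : A} u v → Unique (x ∷ u ++ v) → Unique (u ++ x ∷ v)
Unique-unshift {x = x} u v = Unique-resp-↭ (setoid _) (↭⇒↭ₛ (↭.↭-sym (↭P.shift x u v)))

module _ {m : ℕ} where

  ∈-words : (w : List (Fin m)) → w ∈ words m (length w)
  ∈-words []      = here refl
  ∈-words (a ∷ w) = ∈-concat⁺′ (∈-map⁺ (a ∷_) (∈-words w)) (∈-map⁺ (λ b → map (b ∷_) (words m (length w))) (∈-allFin a))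

  words-length : ∀ k {w} → w ∈ words m k → length w ≡ k
  words-length zero (here refl) = refl
  words-length (suc k) p with ∈-concat⁻′ (map (λ a → map (a ∷_) (words m k)) (allFin m)) p
  ... | _ , q , r with ∈-map⁻ (λ a → map (a ∷_) (words m k)) r
  ... | a , _ , refl with ∈-map⁻ (a ∷_) q
  ... | w , s , refl = cong suc (words-length k s)

  words-unique : ∀ k → Unique (words m k)
  words-unique zero    = [] ∷ []
  words-unique (suc k) =
    Unique-concatMap (λ _ → UniqueP.map⁺ LP.∷-injectiveʳ (words-unique k)) same-head (UniqueP.allFin⁺ m)
    where
    same-head : ∀ {a b w} → w ∈ map (a ∷_) (words m k) → w ∈ map (b ∷_) (words m k) → a ≡ b
    same-head p q with ∈-map⁻ _ p | ∈-map⁻ _ q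
    ... | _ , _ , refl | _ , _ , eq = LP.∷-injectiveˡ eq

module _ {n : ℕ} where

  ∈-perms⁻ : ∀ {w} → w ∈ perms n → length w ≡ n × Unique w
  ∈-perms⁻ p with ∈-filter⁻ (UniqueDec.unique? _≟_) p
  ... | q , u = words-length n q , u

  ∈-perms⁺ : ∀ {w} → length w ≡ n → Unique w → w ∈ perms n
  ∈-perms⁺ {w} len = ∈-filter⁺ (UniqueDec.unique? _≟_) (subst (λ k → w ∈ words n k) len (∈-words w))

  perms-unique : Unique (perms n)
  perms-unique = UniqueP.filter⁺ (UniqueDec.unique? _≟_) (words-unique n)

inserts : ∀ {A : Set} → A → List A → List (List A)
inserts x []      = (x ∷ []) ∷ []
inserts x (a ∷ τ) = (x ∷ a ∷ τ) ∷ map (a ∷_) (inserts x τ)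

map-inserts : ∀ {A B : Set} (f : A → B) x τ → map (map f) (inserts x τ) ≡ inserts (f x) (map f τ)
map-inserts f x []      = refl
map-inserts f x (a ∷ τ) = cong ((f x ∷ f a ∷ map f τ) ∷_) (begin
  map (map f) (map (a ∷_) (inserts x τ))   ≡⟨ LP.map-∘ (inserts x τ) ⟨
  map (map f ∘ (a ∷_)) (inserts x τ)       ≡⟨ LP.map-∘ (inserts x τ) ⟩
  map (f a ∷_) (map (map f) (inserts x τ)) ≡⟨ cong (map (f a ∷_)) (map-inserts f x τ) ⟩
  map (f a ∷_) (inserts (f x) (map f τ))   ∎)
  where open ≡-Reasoning

module _ {A : Set} {x : A} where

  ∈-inserts⁻ : ∀ {τ w} → w ∈ inserts x τ → ∃₂ λ u v → τ ≡ u ++ v × w ≡ u ++ x ∷ v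
  ∈-inserts⁻ {[]}    (here refl) = [] , [] , refl , refl
  ∈-inserts⁻ {a ∷ τ} (here refl) = [] , a ∷ τ , refl , refl
  ∈-inserts⁻ {a ∷ τ} (there p) with ∈-map⁻ (a ∷_) p
  ... | _ , q , refl with ∈-inserts⁻ q
  ... | u , v , refl , refl = a ∷ u , v , refl , refl

  ∈-inserts⁺ : ∀ u v → u ++ x ∷ v ∈ inserts x (u ++ v)
  ∈-inserts⁺ []      []      = here refl
  ∈-inserts⁺ []      (b ∷ v) = here refl
  ∈-inserts⁺ (a ∷ u) v       = there (∈-map⁺ (a ∷_) (∈-inserts⁺ u v))

  inserts-unique : ∀ {τ} → x ∉ τ → Unique (inserts x τ)
  inserts-unique {[]}    _  = [] ∷ []
  inserts-unique {a ∷ τ} x∉ =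
    All.tabulate first-differs ∷ UniqueP.map⁺ LP.∷-injectiveʳ (inserts-unique (x∉ ∘ there))
    where
    first-differs : ∀ {w} → w ∈ map (a ∷_) (inserts x τ) → x ∷ a ∷ τ ≢ w
    first-differs p eq with ∈-map⁻ _ p
    ... | _ , _ , refl = x∉ (here (LP.∷-injectiveˡ eq))

  Unique-inserts : ∀ {τ w} → x ∉ τ → Unique τ → w ∈ inserts x τ → Unique w
  Unique-inserts {τ} x∉ u p with ∈-inserts⁻ p
  ... | l , r , refl , refl = Unique-unshift l r (AllP.¬Any⇒All¬ τ x∉ ∷ u)

  length-inserts : ∀ {τ w} → w ∈ inserts x τ → length w ≡ suc (length τ)
  length-inserts p with ∈-inserts⁻ p
  ... | l , r , refl , refl = LP.length-++-sucʳ l x r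

  filter-inserts : (_≟ₐ_ : DecidableEquality A) → ∀ {τ w} → x ∉ τ → w ∈ inserts x τ →
    filter (λ a → ¬? (a ≟ₐ x)) w ≡ τ
  filter-inserts _≟ₐ_ x∉ p with ∈-inserts⁻ p
  ... | l , r , refl , refl = begin
    filter ≢x? (l ++ x ∷ r)          ≡⟨ LP.filter-++ ≢x? l (x ∷ r) ⟩
    filter ≢x? l ++ filter ≢x? (x ∷ r) ≡⟨ cong₂ _++_ (LP.filter-all ≢x? (≢x ∈-++⁺ˡ))
                                          (trans (LP.filter-reject ≢x? (λ x≢x → x≢x refl)) (LP.filter-all ≢x? (≢x (∈-++⁺ʳ l)))) ⟩
    l ++ r                           ∎
    where
    open ≡-Reasoning
    ≢x? = λ a → ¬? (a ≟ₐ x)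
    ≢x : ∀ {s} → (∀ {a} → a ∈ s → a ∈ l ++ r) → All (_≢ x) s
    ≢x sub = All.tabulate (λ a∈ a≡x → x∉ (subst (_∈ _) a≡x (sub a∈)))

fromℕ∉⇒map-inject₁ : ∀ {m} (w : List (Fin (suc m))) → fromℕ m ∉ w → ∃ λ σ → w ≡ map inject₁ σ
fromℕ∉⇒map-inject₁ []      _  = [] , refl
fromℕ∉⇒map-inject₁ (a ∷ w) m∉ with view a | fromℕ∉⇒map-inject₁ w (m∉ ∘ there)
... | ‵fromℕ     | _        = contradiction (here refl) m∉
... | ‵inject₁ b | σ , refl = b ∷ σ , refl

Unique⇒length≤ : ∀ m (w : List (Fin m)) → Unique w → length w ≤ m
Unique⇒length≤ zero    []      _ = z≤n
Unique⇒length≤ (suc m) w       u with Any.any? (fromℕ m ≟_) w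
... | no m∉ with fromℕ∉⇒map-inject₁ w m∉
...   | σ , refl = ℕP.m≤n⇒m≤1+n (subst (_≤ m) (sym (LP.length-map inject₁ σ)) (Unique⇒length≤ m σ (UniqueP.map⁻ u)))
Unique⇒length≤ (suc m) w       u | yes m∈ with ∈-∃++ m∈
... | l , r , refl with Unique-shift l r u
... | m∉ ∷ u′ with fromℕ∉⇒map-inject₁ (l ++ r) (AllP.All¬⇒¬Any m∉)
... | σ , eq = subst (_≤ suc m) (sym (trans (LP.length-++-sucʳ l _ r) (cong suc (trans (cong length eq) (LP.length-map inject₁ σ)))))
                 (s≤s (Unique⇒length≤ m σ (UniqueP.map⁻ (subst Unique eq u′))))

module _ {m : ℕ} where

  insertMax : List (Fin m) → List (List (Fin (suc m)))
  insertMax σ = inserts (fromℕ m) (map inject₁ σ)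

  fromℕ∉map-inject₁ : (σ : List (Fin m)) → fromℕ m ∉ map inject₁ σ
  fromℕ∉map-inject₁ σ p with ∈-map⁻ inject₁ p
  ... | _ , _ , eq = fromℕ≢inject₁ eq

  fromℕ∈perm : ∀ {π} → π ∈ perms (suc m) → fromℕ m ∈ π
  fromℕ∈perm {π} p with ∈-perms⁻ p | Any.any? (fromℕ m ≟_) π
  ... | _ , _ | yes m∈ = m∈
  ... | len , u | no m∉ with fromℕ∉⇒map-inject₁ π m∉
  ... | σ , refl = contradiction (Unique⇒length≤ m σ (UniqueP.map⁻ u))
                     (subst (λ l → ¬ l ≤ m) (sym (trans (sym (LP.length-map inject₁ σ)) len)) ℕP.1+n≰n)

  insertMax-sound : ∀ {π} → π ∈ concatMap insertMax (perms m) → π ∈ perms (suc m)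
  insertMax-sound p with ∈-concat⁻′ (map insertMax (perms m)) p
  ... | _ , q , r with ∈-map⁻ insertMax r
  ... | σ , σ∈ , refl with ∈-perms⁻ σ∈
  ... | len , u = ∈-perms⁺ (trans (length-inserts q) (cong suc (trans (LP.length-map inject₁ σ) len)))
                    (Unique-inserts (fromℕ∉map-inject₁ σ) (UniqueP.map⁺ inject₁-injective u) q)

  insertMax-complete : ∀ {π} → π ∈ perms (suc m) → π ∈ concatMap insertMax (perms m)
  insertMax-complete p with ∈-perms⁻ p | ∈-∃++ (fromℕ∈perm p)
  ... | len , u | l , r , refl with Unique-shift l r u
  ... | m∉ ∷ u′ with fromℕ∉⇒map-inject₁ (l ++ r) (AllP.All¬⇒¬Any m∉)
  ... | σ , eq = ∈-concat⁺′ (subst (λ τ → l ++ fromℕ m ∷ r ∈ inserts (fromℕ m) τ) eq (∈-inserts⁺ l r))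
                   (∈-map⁺ insertMax (∈-perms⁺ len′ (UniqueP.map⁻ (subst Unique eq u′))))
    where
    len′ : length σ ≡ m
    len′ = ℕP.suc-injective (begin
      suc (length σ)                 ≡⟨ cong suc (sym (LP.length-map inject₁ σ)) ⟩
      suc (length (map inject₁ σ))   ≡⟨ cong (suc ∘ length) (sym eq) ⟩
      suc (length (l ++ r))          ≡⟨ sym (LP.length-++-sucʳ l _ r) ⟩
      length (l ++ fromℕ m ∷ r)      ≡⟨ len ⟩
      suc m                          ∎)
      where open ≡-Reasoning

  insertMax-unique : Unique (concatMap insertMax (perms m))
  insertMax-unique = Unique-concatMap (λ σ → inserts-unique (fromℕ∉map-inject₁ σ)) same-origin perms-unique
    where
    same-origin : ∀ {σ σ′ π} → π ∈ insertMax σ → π ∈ insertMax σ′ → σ ≡ σ′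
    same-origin {σ} {σ′} p q = LP.map-injective inject₁-injective
      (trans (sym (filter-inserts _≟_ (fromℕ∉map-inject₁ σ) p)) (filter-inserts _≟_ (fromℕ∉map-inject₁ σ′) q))

  perms-suc-↭ : perms (suc m) ↭ concatMap insertMax (perms m)
  perms-suc-↭ = ∼bag⇒↭ (unique∧set⇒bag perms-unique insertMax-unique (mk⇔ insertMax-complete insertMax-sound))

  sumℤ-perms-suc : (g : List (Fin (suc m)) → ℤ) →
    sumℤ (map g (perms (suc m))) ≡ sumℤ (map (λ σ → sumℤ (map g (insertMax σ))) (perms m))
  sumℤ-perms-suc g = trans (sumℤ-↭ (↭P.map⁺ g perms-suc-↭)) (sumℤ-concatMap g insertMax (perms m))

-- Peaks under insertion of the maximum

ind : Bool → ℕ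
ind e = if e then 1 else 0

peaks : List ℕ → ℕ
peaks (a ∷ b ∷ c ∷ τ) = ind ((a <ᵇ b) ∧ (c <ᵇ b)) ℕ.+ peaks (b ∷ c ∷ τ)
peaks _               = 0

pk≡peaks : ∀ {n} (w : List (Fin n)) → pk w ≡ peaks (map toℕ w)
pk≡peaks []              = refl
pk≡peaks (_ ∷ [])        = refl
pk≡peaks (_ ∷ _ ∷ [])    = refl
pk≡peaks (a ∷ b ∷ c ∷ τ) = cong (_ ℕ.+_) (pk≡peaks (b ∷ c ∷ τ))

<ᵇ-true : ∀ {m n} → m < n → (m <ᵇ n) ≡ true
<ᵇ-true {m} {n} m<n with m <ᵇ n | ℕP.<⇒<ᵇ m<n
... | true | _ = refl

<ᵇ-false : ∀ {m n} → n ≤ m → (m <ᵇ n) ≡ false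
<ᵇ-false {m} {n} n≤m with m <ᵇ n | ℕP.<ᵇ⇒< m n
... | false | _   = refl
... | true  | m<n = contradiction (m<n _) (ℕP.≤⇒≯ n≤m)

peaks-desc : ∀ {a b} τ → b ≤ a → peaks (a ∷ b ∷ τ) ≡ peaks (b ∷ τ)
peaks-desc []      _   = refl
peaks-desc (_ ∷ _) b≤a rewrite <ᵇ-false b≤a = refl

peaks-asc : ∀ {a b c} τ → b ≤ c → peaks (a ∷ b ∷ c ∷ τ) ≡ peaks (b ∷ c ∷ τ)
peaks-asc {a} {b} τ b≤c rewrite <ᵇ-false b≤c | BoolP.∧-zeroʳ (a <ᵇ b) = refl

peaks-around : ∀ {a b M} τ → a < M → b < M → peaks (a ∷ M ∷ b ∷ τ) ≡ suc (peaks (b ∷ τ))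
peaks-around τ a<M b<M rewrite <ᵇ-true a<M | <ᵇ-true b<M = cong suc (peaks-desc τ (ℕP.<⇒≤ b<M))

peak⇒desc : ∀ {a b c} → ((a <ᵇ b) ∧ (c <ᵇ b)) ≡ true → c < b
peak⇒desc {a} {b} {c} eq with a <ᵇ b | c <ᵇ b | ℕP.<ᵇ⇒< c b
peak⇒desc ()  | false | _    | _
peak⇒desc ()  | true  | false | _
peak⇒desc _   | true  | true | c<b = c<b _

-- Σ h(peak count) over L + 1 insertion slots, when 2k + 1 of them keep the peak count k
-- and the other L − 2k raise it to k + 1.
slotSum : (L k : ℕ) → (ℕ → ℤ) → ℤ
slotSum L k h = (+ 1 + + 2 * + k) * h k + (+ L - + 2 * + k) * h (suc k)

slotSum-step : ∀ (e : Bool) (h : ℕ → ℤ) (L k K : ℕ) (R : ℤ) → (e ≡ true → k ≡ K) →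
  h (ind e ℕ.+ suc K) + R ≡ slotSum (suc L) k (λ t → h (ind e ℕ.+ t)) →
  h (suc k) + (h (suc K) + R) ≡ slotSum (suc (suc L)) (ind e ℕ.+ k) h
slotSum-step false h L k K R _ ih = begin
  h (suc k) + (h (suc K) + R)          ≡⟨ cong (λ t → h (suc k) + t) ih ⟩
  h (suc k) + slotSum (suc L) k h      ≡⟨ shift-slot (h k) (h (suc k)) (+ L) (+ k) ⟩
  slotSum (suc (suc L)) k h            ∎
  where
  open ≡-Reasoning
  shift-slot : ∀ x y L k → y + ((+ 1 + + 2 * k) * x + (+ 1 + L - + 2 * k) * y)
                         ≡ (+ 1 + + 2 * k) * x + (+ 1 + (+ 1 + L) - + 2 * k) * y
  shift-slot = solve-∀
slotSum-step true h L k K R k≡K ih with k≡K refl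
... | refl = begin
  h (suc k) + (h (suc k) + R)                                   ≡⟨ regroup (h (suc k)) (h (suc (suc k))) R ⟩
  h (suc k) + h (suc k) + (h (suc (suc k)) + R) - h (suc (suc k)) ≡⟨ cong (λ t → h (suc k) + h (suc k) + t - h (suc (suc k))) ih ⟩
  h (suc k) + h (suc k) + slotSum (suc L) k (h ∘ suc) - h (suc (suc k)) ≡⟨ raise-peak (h (suc k)) (h (suc (suc k))) (+ L) (+ k) ⟩
  slotSum (suc (suc L)) (suc k) h                               ∎
  where
  open ≡-Reasoning
  regroup : ∀ x y r → x + (x + r) ≡ x + x + (y + r) - y
  regroup = solve-∀
  raise-peak : ∀ x y L k → x + x + ((+ 1 + + 2 * k) * x + (+ 1 + L - + 2 * k) * y) - y
                         ≡ (+ 1 + + 2 * (+ 1 + k)) * x + (+ 1 + (+ 1 + L) - + 2 * (+ 1 + k)) * y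
  raise-peak = solve-∀

module _ (M : ℕ) where

  -- Stated for every h so that the induction hypothesis applies to h shifted by the peak at b,
  -- whose presence depends on the entry following b.
  peaks-inserts-after : ∀ (h : ℕ → ℤ) a τ → All (_< M) (a ∷ τ) →
    sumℤ (map (λ w → h (peaks (a ∷ w))) (inserts M τ)) ≡ slotSum (length τ) (peaks (a ∷ τ)) h
  peaks-inserts-after h a [] _ = one-slot (h 0) (h 1)
    where
    one-slot : ∀ x y → x + + 0 ≡ (+ 1 + + 2 * + 0) * x + (+ 0 - + 2 * + 0) * y
    one-slot = solve-∀
  peaks-inserts-after h a (b ∷ []) (a<M ∷ b<M ∷ []) = begin
    h (peaks (a ∷ M ∷ b ∷ [])) + (h (peaks (a ∷ b ∷ M ∷ [])) + + 0)
      ≡⟨ cong₂ (λ p q → h p + (h q + + 0)) (peaks-around [] a<M b<M) (peaks-asc [] (ℕP.<⇒≤ b<M)) ⟩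
    h 1 + (h 0 + + 0)
      ≡⟨ two-slots (h 0) (h 1) ⟩
    slotSum 1 0 h ∎
    where
    open ≡-Reasoning
    two-slots : ∀ x y → y + (x + + 0) ≡ (+ 1 + + 2 * + 0) * x + (+ 1 - + 2 * + 0) * y
    two-slots = solve-∀
  peaks-inserts-after h a (b ∷ τ@(c ∷ ρ)) (a<M ∷ b<M∷τ<M@(b<M ∷ c<M ∷ _)) = begin
    h (peaks (a ∷ M ∷ b ∷ c ∷ ρ)) + (h (peaks (a ∷ b ∷ M ∷ c ∷ ρ)) + S)
      ≡⟨ cong₂ (λ p q → h p + (h q + S)) (peaks-around (c ∷ ρ) a<M b<M) (trans (peaks-asc (c ∷ ρ) (ℕP.<⇒≤ b<M)) (peaks-around ρ b<M c<M)) ⟩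
    h (suc k) + (h (suc K) + S)
      ≡⟨ cong (λ t → h (suc k) + (h (suc K) + t)) (trans (sumℤ-map-∘ (λ w → h (peaks (a ∷ w))) (b ∷_) (map (c ∷_) (inserts M ρ)))
                                                        (sumℤ-map-∘ (λ w → h (peaks (a ∷ b ∷ w))) (c ∷_) (inserts M ρ))) ⟩
    h (suc k) + (h (suc K) + R)
      ≡⟨ slotSum-step e h (length ρ) k K R b-peak⇒k≡K
           (first-slot (peaks-inserts-after (λ t → h (ind e ℕ.+ t)) b τ b<M∷τ<M)) ⟩
    slotSum (length (b ∷ c ∷ ρ)) (peaks (a ∷ b ∷ c ∷ ρ)) h ∎
    where
    open ≡-Reasoning
    e = (a <ᵇ b) ∧ (c <ᵇ b)
    k = peaks (b ∷ c ∷ ρ)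
    K = peaks (c ∷ ρ)
    S = sumℤ (map (λ w → h (peaks (a ∷ w))) (map (b ∷_) (map (c ∷_) (inserts M ρ))))
    R = sumℤ (map (λ w → h (peaks (a ∷ b ∷ c ∷ w))) (inserts M ρ))
    b-peak⇒k≡K : e ≡ true → k ≡ K
    b-peak⇒k≡K = peaks-desc ρ ∘ ℕP.<⇒≤ ∘ peak⇒desc
    first-slot : ∀ {X} → sumℤ (map (λ w → h (ind e ℕ.+ peaks (b ∷ w))) (inserts M τ)) ≡ X → h (ind e ℕ.+ suc K) + R ≡ X
    first-slot = trans (cong₂ (λ p t → h (ind e ℕ.+ p) + t) (sym (peaks-around ρ b<M c<M))
                                                         (sym (sumℤ-map-∘ (λ w → h (ind e ℕ.+ peaks (b ∷ w))) (c ∷_) (inserts M ρ))))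

  peaks-inserts : ∀ (h : ℕ → ℤ) a τ → All (_< M) (a ∷ τ) →
    sumℤ (map (h ∘ peaks) (inserts M (a ∷ τ))) ≡ h (peaks (a ∷ τ)) + slotSum (length τ) (peaks (a ∷ τ)) h
  peaks-inserts h a τ a∷τ<M@(a<M ∷ _) =
    cong₂ _+_ (cong h (peaks-desc τ (ℕP.<⇒≤ a<M)))
              (trans (sumℤ-map-∘ (h ∘ peaks) (a ∷_) (inserts M τ)) (peaks-inserts-after h a τ a∷τ<M))

pk-insertMax : ∀ {m} (h : ℕ → ℤ) (a : Fin m) τ →
  sumℤ (map (h ∘ pk) (insertMax (a ∷ τ))) ≡ h (pk (a ∷ τ)) + slotSum (length τ) (pk (a ∷ τ)) h
pk-insertMax {m} h a τ = begin
  sumℤ (map (h ∘ pk) (insertMax (a ∷ τ)))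
    ≡⟨ cong sumℤ (LP.map-cong (cong h ∘ pk≡peaks) (insertMax (a ∷ τ))) ⟩
  sumℤ (map (h ∘ peaks ∘ map toℕ) (insertMax (a ∷ τ)))
    ≡⟨ sumℤ-map-∘ (h ∘ peaks) (map toℕ) (insertMax (a ∷ τ)) ⟨
  sumℤ (map (h ∘ peaks) (map (map toℕ) (insertMax (a ∷ τ))))
    ≡⟨ cong (sumℤ ∘ map (h ∘ peaks)) (trans (map-inserts toℕ (fromℕ m) (map inject₁ (a ∷ τ)))
                                            (cong₂ inserts (toℕ-fromℕ m) toℕ-inject₁-list)) ⟩
  sumℤ (map (h ∘ peaks) (inserts m (map toℕ (a ∷ τ))))
    ≡⟨ peaks-inserts m h (toℕ a) (map toℕ τ) (AllP.map⁺ (All.universal toℕ<n (a ∷ τ))) ⟩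
  h (peaks (map toℕ (a ∷ τ))) + slotSum (length (map toℕ τ)) (peaks (map toℕ (a ∷ τ))) h
    ≡⟨ cong₂ (λ k L → h k + slotSum L k h) (sym (pk≡peaks (a ∷ τ))) (LP.length-map toℕ τ) ⟩
  h (pk (a ∷ τ)) + slotSum (length τ) (pk (a ∷ τ)) h ∎
  where
  open ≡-Reasoning
  toℕ-inject₁-list : map toℕ (map inject₁ (a ∷ τ)) ≡ map toℕ (a ∷ τ)
  toℕ-inject₁-list = trans (sym (LP.map-∘ (a ∷ τ))) (LP.map-cong toℕ-inject₁ (a ∷ τ))

-- Polynomials as integer coefficient sequences

Poly : Set
Poly = ℕ → ℤ

mono : ℕ → Poly
mono zero    zero    = + 1
mono zero    (suc i) = + 0
mono (suc j) zero    = + 0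
mono (suc j) (suc i) = mono j i

mulX : Poly → Poly
mulX f zero    = + 0
mulX f (suc i) = f i

-- Θ f represents 2x(1 − x) f′.
Θ : Poly → Poly
Θ f zero    = + 0
Θ f (suc i) = + 2 * + suc i * f (suc i) - + 2 * + i * f i

-- grow L maps x P_{L−1}(x) to x P_L(x).
grow : ℕ → Poly → Poly
grow L f i = + L * mulX f i + Θ f i

-- bern j e represents xʲ (1 − x)ᵉ.
bern : ℕ → ℕ → Poly
bern j zero    = mono j
bern j (suc e) i = bern j e i - mulX (bern j e) i

bernSum : ℕ → (ℕ → ℤ) → Poly
bernSum n a i = sum1to n (λ j → a j * bern j (n ∸ j) i)

record IsLinear (φ : Poly → ℤ) : Set where
  field
    cong-≗ : ∀ {f g} → f ≗ g → φ f ≡ φ g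
    +-homo : ∀ f g → φ (λ i → f i + g i) ≡ φ f + φ g
    *-homo : ∀ a f → φ (λ i → a * f i) ≡ a * φ f

  0-homo : φ (λ _ → + 0) ≡ + 0
  0-homo = *-homo (+ 0) (λ _ → + 0)

  sub-homo : ∀ f g → φ (λ i → f i - g i) ≡ φ f - φ g
  sub-homo f g = begin
    φ (λ i → f i - g i)           ≡⟨ cong-≗ (λ i → cong (_+_ (f i)) (sym (ℤP.-1*i≡-i (g i)))) ⟩
    φ (λ i → f i + -1ℤ * g i)     ≡⟨ +-homo f (λ i → -1ℤ * g i) ⟩
    φ f + φ (λ i → -1ℤ * g i)     ≡⟨ cong (_+_ (φ f)) (trans (*-homo -1ℤ g) (ℤP.-1*i≡-i (φ g))) ⟩
    φ f - φ g                     ∎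
    where open ≡-Reasoning

  lincomb-homo : ∀ a b f g → φ (λ i → a * f i - b * g i) ≡ a * φ f - b * φ g
  lincomb-homo a b f g = trans (sub-homo (λ i → a * f i) (λ i → b * g i)) (cong₂ _-_ (*-homo a f) (*-homo b g))

  sumℤ-homo : ∀ {A : Set} (g : A → Poly) (xs : List A) →
    φ (λ i → sumℤ (map (λ a → g a i) xs)) ≡ sumℤ (map (φ ∘ g) xs)
  sumℤ-homo g []       = 0-homo
  sumℤ-homo g (a ∷ xs) = trans (+-homo (g a) _) (cong (_+_ (φ (g a))) (sumℤ-homo g xs))

  sum1to-homo : ∀ n (a : ℕ → ℤ) (g : ℕ → Poly) →
    φ (λ i → sum1to n (λ j → a j * g j i)) ≡ sum1to n (λ j → a j * φ (g j))
  sum1to-homo zero    a g = 0-homo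
  sum1to-homo (suc n) a g =
    trans (+-homo (λ i → sum1to n (λ j → a j * g j i)) (λ i → a (suc n) * g (suc n) i))
          (cong₂ _+_ (sum1to-homo n a g) (*-homo (a (suc n)) (g (suc n))))

IsLinear-lincomb : ∀ (c : ℤ) {φ ψ : Poly → ℤ} → IsLinear φ → IsLinear ψ → IsLinear (λ f → c * φ f + ψ f)
IsLinear-lincomb c φ-lin ψ-lin = record
  { cong-≗ = λ f≗g → cong₂ (λ u v → c * u + v) (Φ.cong-≗ f≗g) (Ψ.cong-≗ f≗g)
  ; +-homo = λ f g → trans (cong₂ (λ u v → c * u + v) (Φ.+-homo f g) (Ψ.+-homo f g)) (+-regroup c _ _ _ _)
  ; *-homo = λ a f → trans (cong₂ (λ u v → c * u + v) (Φ.*-homo a f) (Ψ.*-homo a f)) (*-regroup c a _ _)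
  }
  where
  module Φ = IsLinear φ-lin
  module Ψ = IsLinear ψ-lin
  +-regroup : ∀ c u u′ v v′ → c * (u + u′) + (v + v′) ≡ (c * u + v) + (c * u′ + v′)
  +-regroup = solve-∀
  *-regroup : ∀ c a u v → c * (a * u) + a * v ≡ a * (c * u + v)
  *-regroup = solve-∀

mulX-linear : ∀ i → IsLinear (λ f → mulX f i)
mulX-linear zero    = record { cong-≗ = λ _ → refl ; +-homo = λ _ _ → refl ; *-homo = λ a _ → sym (ℤP.*-zeroʳ a) }
mulX-linear (suc i) = record { cong-≗ = λ f≗g → f≗g i ; +-homo = λ _ _ → refl ; *-homo = λ _ _ → refl }

Θ-linear : ∀ i → IsLinear (λ f → Θ f i)
Θ-linear zero    = record { cong-≗ = λ _ → refl ; +-homo = λ _ _ → refl ; *-homo = λ a _ → sym (ℤP.*-zeroʳ a) }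
Θ-linear (suc i) = record
  { cong-≗ = λ f≗g → cong₂ (λ u v → p * u - q * v) (f≗g (suc i)) (f≗g i)
  ; +-homo = λ f g → +-regroup p q (f (suc i)) (g (suc i)) (f i) (g i)
  ; *-homo = λ a f → *-regroup p q a (f (suc i)) (f i)
  }
  where
  p = + 2 * + suc i
  q = + 2 * + i
  +-regroup : ∀ p q u u′ v v′ → p * (u + u′) - q * (v + v′) ≡ (p * u - q * v) + (p * u′ - q * v′)
  +-regroup = solve-∀
  *-regroup : ∀ p q a u v → p * (a * u) - q * (a * v) ≡ a * (p * u - q * v)
  *-regroup = solve-∀

grow-linear : ∀ L i → IsLinear (λ f → grow L f i)
grow-linear L i = IsLinear-lincomb (+ L) (mulX-linear i) (Θ-linear i)

mono-scale : ∀ j i → + i * mono j i ≡ + j * mono j i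
mono-scale zero    zero    = refl
mono-scale zero    (suc i) = ℤP.*-zeroʳ (+ suc i)
mono-scale (suc j) zero    = sym (ℤP.*-zeroʳ (+ suc j))
mono-scale (suc j) (suc i) = begin
  (+ 1 + + i) * mono j i        ≡⟨ ℤP.*-distribʳ-+ (mono j i) (+ 1) (+ i) ⟩
  + 1 * mono j i + + i * mono j i ≡⟨ cong (_+_ (+ 1 * mono j i)) (mono-scale j i) ⟩
  + 1 * mono j i + + j * mono j i ≡⟨ ℤP.*-distribʳ-+ (mono j i) (+ 1) (+ j) ⟨
  (+ 1 + + j) * mono j i        ∎
  where open ≡-Reasoning

mulX-mono : ∀ j → mulX (mono j) ≗ mono (suc j)
mulX-mono j zero    = refl
mulX-mono j (suc i) = refl

Θ-mono : ∀ j i → Θ (mono j) i ≡ + 2 * + j * (mono j i - mono (suc j) i)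
Θ-mono zero    zero    = refl
Θ-mono (suc j) zero    = sym (ℤP.*-zeroʳ (+ 2 * + suc j))
Θ-mono j       (suc i) = begin
  + 2 * + suc i * u - + 2 * + i * v        ≡⟨ regroup (+ 2) (+ suc i) (+ i) u v ⟩
  + 2 * (+ suc i * u) - + 2 * (+ i * v)    ≡⟨ cong₂ (λ s t → + 2 * s - + 2 * t) (mono-scale j (suc i)) (mono-scale j i) ⟩
  + 2 * (+ j * u) - + 2 * (+ j * v)        ≡⟨ factor (+ j) u v ⟩
  + 2 * + j * (u - v)                      ∎
  where
  open ≡-Reasoning
  u = mono j (suc i)
  v = mono j i
  regroup : ∀ a s t u v → a * s * u - a * t * v ≡ a * (s * u) - a * (t * v)
  regroup = solve-∀
  factor : ∀ j u v → + 2 * (j * u) - + 2 * (j * v) ≡ + 2 * j * (u - v)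
  factor = solve-∀

Θ-mulX : ∀ f i → Θ (mulX f) i ≡ mulX (Θ f) i + + 2 * mulX f i - + 2 * mulX (mulX f) i
Θ-mulX f zero          = refl
Θ-mulX f (suc zero)    = product-rule₁ (f 0)
  where
  product-rule₁ : ∀ a → + 2 * + 1 * a - + 2 * + 0 * + 0 ≡ + 0 + + 2 * a - + 2 * + 0
  product-rule₁ = solve-∀
Θ-mulX f (suc (suc i)) = product-rule (+ i) (f (suc i)) (f i)
  where
  product-rule : ∀ k a b → + 2 * (+ 1 + (+ 1 + k)) * a - + 2 * (+ 1 + k) * b
                         ≡ (+ 2 * (+ 1 + k) * a - + 2 * k * b) + + 2 * a - + 2 * b
  product-rule = solve-∀

bern-suc-0 : ∀ j e → bern (suc j) e 0 ≡ + 0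
bern-suc-0 j zero    = refl
bern-suc-0 j (suc e) = cong (_- + 0) (bern-suc-0 j e)

mulX-bern : ∀ j e → mulX (bern j e) ≗ bern (suc j) e
mulX-bern j zero    = mulX-mono j
mulX-bern j (suc e) zero    = sym (cong (_- + 0) (bern-suc-0 j e))
mulX-bern j (suc e) (suc i) = cong₂ _-_ (mulX-bern j e (suc i)) (mulX-bern j e i)

bern-split : ∀ j e i → bern j e i ≡ bern j (suc e) i + bern (suc j) e i
bern-split j e i = sym (trans (cong (λ t → bern j e i - t + bern (suc j) e i) (mulX-bern j e i)) (cancel _ _))
  where
  cancel : ∀ a b → a - b + b ≡ a
  cancel = solve-∀

Θ-bern : ∀ j e i → Θ (bern j e) i ≡ + 2 * + j * bern j (suc e) i - + 2 * + e * bern (suc j) e i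
Θ-bern j zero    i = begin
  Θ (mono j) i                                          ≡⟨ Θ-mono j i ⟩
  + 2 * + j * (mono j i - mono (suc j) i)                 ≡⟨ cong (λ t → + 2 * + j * (mono j i - t)) (mulX-mono j i) ⟨
  + 2 * + j * (mono j i - mulX (mono j) i)                ≡⟨ pad _ (mono (suc j) i) ⟩
  + 2 * + j * bern j 1 i - + 2 * + 0 * bern (suc j) 0 i   ∎
  where
  open ≡-Reasoning
  pad : ∀ a b → a ≡ a - + 2 * + 0 * b
  pad = solve-∀
Θ-bern j (suc e) i = begin
  Θ (bern j (suc e)) i
    ≡⟨ IsLinear.sub-homo (Θ-linear i) (bern j e) (mulX (bern j e)) ⟩
  Θ (bern j e) i - Θ (mulX (bern j e)) i
    ≡⟨ cong₂ _-_ (Θ-bern j e i) (Θ-mulX (bern j e) i) ⟩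
  + 2 * + j * A - + 2 * + e * C - (mulX (Θ (bern j e)) i + + 2 * mulX (bern j e) i - + 2 * mulX (mulX (bern j e)) i)
    ≡⟨ cong₂ (λ s t → + 2 * + j * A - + 2 * + e * C - (s + + 2 * t - + 2 * mulX (mulX (bern j e)) i)) XΘb Xb ⟩
  + 2 * + j * A - + 2 * + e * C - (+ 2 * + j * (C - D) - + 2 * + e * D + + 2 * C - + 2 * mulX (mulX (bern j e)) i)
    ≡⟨ cong (λ t → + 2 * + j * A - + 2 * + e * C - (+ 2 * + j * (C - D) - + 2 * + e * D + + 2 * C - + 2 * t)) XXb ⟩
  + 2 * + j * A - + 2 * + e * C - (+ 2 * + j * (C - D) - + 2 * + e * D + + 2 * C - + 2 * D)
    ≡⟨ regroup (+ j) (+ e) A C D ⟩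
  + 2 * + j * (A - (C - D)) - + 2 * (+ 1 + + e) * (C - D)
    ≡⟨ cong₂ (λ s t → + 2 * + j * (A - s) - + 2 * (+ 1 + + e) * (C - t)) (sym XA) (sym (mulX-bern (suc j) e i)) ⟩
  + 2 * + j * bern j (suc (suc e)) i - + 2 * + suc e * bern (suc j) (suc e) i
    ∎
  where
  open ≡-Reasoning
  module Xᵢ = IsLinear (mulX-linear i)
  A = bern j (suc e) i
  C = bern (suc j) e i
  D = bern (suc (suc j)) e i
  Xb : mulX (bern j e) i ≡ C
  Xb = mulX-bern j e i
  XXb : mulX (mulX (bern j e)) i ≡ D
  XXb = trans (Xᵢ.cong-≗ (mulX-bern j e)) (mulX-bern (suc j) e i)
  XA : mulX (bern j (suc e)) i ≡ C - D
  XA = trans (mulX-bern j (suc e) i) (cong (C -_) (mulX-bern (suc j) e i))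
  XΘb : mulX (Θ (bern j e)) i ≡ + 2 * + j * (C - D) - + 2 * + e * D
  XΘb = trans (Xᵢ.cong-≗ (Θ-bern j e))
       (trans (Xᵢ.lincomb-homo (+ 2 * + j) (+ 2 * + e) (bern j (suc e)) (bern (suc j) e))
              (cong₂ (λ s t → + 2 * + j * s - + 2 * + e * t) XA (mulX-bern (suc j) e i)))
  regroup : ∀ j e A C D → + 2 * j * A - + 2 * e * C - (+ 2 * j * (C - D) - + 2 * e * D + + 2 * C - + 2 * D)
                        ≡ + 2 * j * (A - (C - D)) - + 2 * (+ 1 + e) * (C - D)
  regroup = solve-∀

grow-bern : ∀ L j e i →
  grow L (bern j e) i ≡ (+ L - + 2 * + e) * bern (suc j) e i + + 2 * + j * bern j (suc e) i
grow-bern L j e i =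
  trans (cong₂ (λ u v → + L * u + v) (mulX-bern j e i) (Θ-bern j e i)) (regroup (+ L) (+ j) (+ e) _ _)
  where
  regroup : ∀ L j e u a → L * u + (+ 2 * j * a - + 2 * e * u) ≡ (L - + 2 * e) * u + + 2 * j * a
  regroup = solve-∀

grow-bern-even : ∀ j e i → grow (2 ℕ.* (j ℕ.+ e)) (bern j e) i ≡ + 2 * + j * bern j e i
grow-bern-even j e i = begin
  grow (2 ℕ.* (j ℕ.+ e)) (bern j e) i
    ≡⟨ grow-bern (2 ℕ.* (j ℕ.+ e)) j e i ⟩
  (+ (2 ℕ.* (j ℕ.+ e)) - + 2 * + e) * bern (suc j) e i + + 2 * + j * bern j (suc e) i
    ≡⟨ cong (λ t → (t - + 2 * + e) * bern (suc j) e i + + 2 * + j * bern j (suc e) i) (ℤP.pos-* 2 (j ℕ.+ e)) ⟩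
  (+ 2 * (+ j + + e) - + 2 * + e) * bern (suc j) e i + + 2 * + j * bern j (suc e) i
    ≡⟨ collect (+ j) (+ e) (bern (suc j) e i) (bern j (suc e) i) ⟩
  + 2 * + j * (bern j (suc e) i + bern (suc j) e i)
    ≡⟨ cong (+ 2 * + j *_) (bern-split j e i) ⟨
  + 2 * + j * bern j e i ∎
  where
  open ≡-Reasoning
  collect : ∀ j e u v → (+ 2 * (j + e) - + 2 * e) * u + + 2 * j * v ≡ + 2 * j * (v + u)
  collect = solve-∀

grow-bern-odd : ∀ j e i →
  grow (suc (2 ℕ.* (j ℕ.+ e))) (bern j e) i ≡ + 2 * + j * bern j (suc e) i + (+ 1 + + 2 * + j) * bern (suc j) e i
grow-bern-odd j e i = begin
  grow (suc (2 ℕ.* (j ℕ.+ e))) (bern j e) i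
    ≡⟨ grow-bern (suc (2 ℕ.* (j ℕ.+ e))) j e i ⟩
  (+ 1 + + (2 ℕ.* (j ℕ.+ e)) - + 2 * + e) * bern (suc j) e i + + 2 * + j * bern j (suc e) i
    ≡⟨ cong (λ t → (+ 1 + t - + 2 * + e) * bern (suc j) e i + + 2 * + j * bern j (suc e) i) (ℤP.pos-* 2 (j ℕ.+ e)) ⟩
  (+ 1 + + 2 * (+ j + + e) - + 2 * + e) * bern (suc j) e i + + 2 * + j * bern j (suc e) i
    ≡⟨ collect (+ j) (+ e) (bern (suc j) e i) (bern j (suc e) i) ⟩
  + 2 * + j * bern j (suc e) i + (+ 1 + + 2 * + j) * bern (suc j) e i ∎
  where
  open ≡-Reasoning
  collect : ∀ j e u v → (+ 1 + + 2 * (j + e) - + 2 * e) * u + + 2 * j * v ≡ + 2 * j * v + (+ 1 + + 2 * j) * u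
  collect = solve-∀

grow-bernSum-even : ∀ n (a : ℕ → ℤ) → grow (2 ℕ.* n) (bernSum n a) ≗ bernSum n (λ j → + 2 * + j * a j)
grow-bernSum-even n a i = begin
  grow (2 ℕ.* n) (bernSum n a) i
    ≡⟨ IsLinear.sum1to-homo (grow-linear (2 ℕ.* n) i) n a (λ j → bern j (n ∸ j)) ⟩
  sum1to n (λ j → a j * grow (2 ℕ.* n) (bern j (n ∸ j)) i)
    ≡⟨ sum1to-cong n (λ j j<n → term (suc j) j<n) ⟩
  sum1to n (λ j → + 2 * + j * a j * bern j (n ∸ j) i) ∎
  where
  open ≡-Reasoning
  term : ∀ j → j ≤ n → a j * grow (2 ℕ.* n) (bern j (n ∸ j)) i ≡ + 2 * + j * a j * bern j (n ∸ j) i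
  term j j≤n = begin
    a j * grow (2 ℕ.* n) (bern j (n ∸ j)) i                 ≡⟨ cong (λ m → a j * grow (2 ℕ.* m) (bern j (n ∸ j)) i) (ℕP.m+[n∸m]≡n j≤n) ⟨
    a j * grow (2 ℕ.* (j ℕ.+ (n ∸ j))) (bern j (n ∸ j)) i   ≡⟨ cong (a j *_) (grow-bern-even j (n ∸ j) i) ⟩
    a j * (+ 2 * + j * bern j (n ∸ j) i)                    ≡⟨ swap (a j) (+ j) (bern j (n ∸ j) i) ⟩
    + 2 * + j * a j * bern j (n ∸ j) i                      ∎
    where
    swap : ∀ a j b → a * (+ 2 * j * b) ≡ + 2 * j * a * b
    swap = solve-∀

oddNext : (ℕ → ℤ) → ℕ → ℤ
oddNext d zero    = + 0
oddNext d (suc j) = + 2 * + suc j * d (suc j) + (+ 1 + + 2 * + j) * d j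

grow-bernSum-odd : ∀ n (d : ℕ → ℤ) → d 0 ≡ + 0 → d (suc n) ≡ + 0 →
  grow (suc (2 ℕ.* n)) (bernSum n d) ≗ bernSum (suc n) (oddNext d)
grow-bernSum-odd n d d₀≡0 dₙ₊₁≡0 i = begin
  grow (suc (2 ℕ.* n)) (bernSum n d) i
    ≡⟨ IsLinear.sum1to-homo (grow-linear (suc (2 ℕ.* n)) i) n d (λ j → bern j (n ∸ j)) ⟩
  sum1to n (λ j → d j * grow (suc (2 ℕ.* n)) (bern j (n ∸ j)) i)
    ≡⟨ sum1to-cong n (λ j j<n → term (suc j) j<n) ⟩
  sum1to n (λ j → right j + up j)
    ≡⟨ sum1to-+ n right up ⟩
  sum1to n right + sum1to n up
    ≡⟨ cong₂ _+_ (sum1to-drop-last n right (annihilate (+ 2 * + suc n) dₙ₊₁≡0 (bern (suc n) (n ∸ n) i)))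
                 (sum1to-drop-first n up′ (annihilate (+ 1 + + 2 * + 0) d₀≡0 (bern 1 n i))) ⟨
  sum1to (suc n) right + sum1to (suc n) up′
    ≡⟨ sum1to-+ (suc n) right up′ ⟨
  sum1to (suc n) (λ j → right j + up′ j)
    ≡⟨ sum1to-cong (suc n) (λ j _ → distrib (+ 2 * + suc j) (+ 1 + + 2 * + j) (d (suc j)) (d j) (bern (suc j) (n ∸ j) i)) ⟩
  bernSum (suc n) (oddNext d) i ∎
  where
  open ≡-Reasoning
  right up up′ : ℕ → ℤ
  right j = + 2 * + j * d j * bern j (suc n ∸ j) i
  up j    = (+ 1 + + 2 * + j) * d j * bern (suc j) (n ∸ j) i
  up′ zero    = + 0
  up′ (suc j) = up j

  annihilate : ∀ a {b} → b ≡ + 0 → ∀ c → a * b * c ≡ + 0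
  annihilate a refl c = vanish a c
    where
    vanish : ∀ a c → a * + 0 * c ≡ + 0
    vanish = solve-∀
  distrib : ∀ p q u v b → p * u * b + q * v * b ≡ (p * u + q * v) * b
  distrib = solve-∀

  term : ∀ j → j ≤ n → d j * grow (suc (2 ℕ.* n)) (bern j (n ∸ j)) i ≡ right j + up j
  term j j≤n = begin
    d j * grow (suc (2 ℕ.* n)) (bern j (n ∸ j)) i
      ≡⟨ cong (λ m → d j * grow (suc (2 ℕ.* m)) (bern j (n ∸ j)) i) (ℕP.m+[n∸m]≡n j≤n) ⟨
    d j * grow (suc (2 ℕ.* (j ℕ.+ (n ∸ j)))) (bern j (n ∸ j)) i
      ≡⟨ cong (d j *_) (grow-bern-odd j (n ∸ j) i) ⟩
    d j * (+ 2 * + j * bern j (suc (n ∸ j)) i + (+ 1 + + 2 * + j) * bern (suc j) (n ∸ j) i)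
      ≡⟨ spread (d j) (+ j) (bern j (suc (n ∸ j)) i) (bern (suc j) (n ∸ j) i) ⟩
    + 2 * + j * d j * bern j (suc (n ∸ j)) i + up j
      ≡⟨ cong (λ e → + 2 * + j * d j * bern j e i + up j) (ℕP.+-∸-assoc 1 j≤n) ⟨
    right j + up j ∎
    where
    spread : ∀ c j u v → c * (+ 2 * j * u + (+ 1 + + 2 * j) * v) ≡ + 2 * j * c * u + (+ 1 + + 2 * j) * c * v
    spread = solve-∀


ev : ℕ → Poly → ℤ → ℤ
ev zero    f x = f 0
ev (suc N) f x = f 0 + x * ev N (f ∘ suc) x

ev-linear : ∀ N x → IsLinear (λ f → ev N f x)
ev-linear zero    x = record { cong-≗ = λ f≗g → f≗g 0 ; +-homo = λ _ _ → refl ; *-homo = λ _ _ → refl }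
ev-linear (suc N) x = record
  { cong-≗ = λ f≗g → cong₂ (λ u v → u + x * v) (f≗g 0) (Ev.cong-≗ (f≗g ∘ suc))
  ; +-homo = λ f g → trans (cong (λ v → f 0 + g 0 + x * v) (Ev.+-homo (f ∘ suc) (g ∘ suc))) (+-regroup x (f 0) (g 0) (ev N (f ∘ suc) x) (ev N (g ∘ suc) x))
  ; *-homo = λ a f → trans (cong (λ v → a * f 0 + x * v) (Ev.*-homo a (f ∘ suc))) (*-regroup x a (f 0) (ev N (f ∘ suc) x))
  }
  where
  module Ev = IsLinear (ev-linear N x)
  +-regroup : ∀ x a b u v → a + b + x * (u + v) ≡ a + x * u + (b + x * v)
  +-regroup = solve-∀
  *-regroup : ∀ x c a u → c * a + x * (c * u) ≡ c * (a + x * u)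
  *-regroup = solve-∀

ev-mono : ∀ x {j N} → j ≤ N → ev N (mono j) x ≡ x ^ j
ev-mono x {zero}  {zero}  _         = refl
ev-mono x {zero}  {suc N} _         =
  trans (cong (λ v → + 1 + x * v) (IsLinear.0-homo (ev-linear N x))) (cong (_+_ (+ 1)) (ℤP.*-zeroʳ x))
ev-mono x {suc j} {suc N} (s≤s j≤N) = trans (ℤP.+-identityˡ _) (cong (x *_) (ev-mono x j≤N))

ev-mulX : ∀ N f x → ev (suc N) (mulX f) x ≡ x * ev N f x
ev-mulX N f x = ℤP.+-identityˡ _

ev-bern : ∀ x j e {N} → j ℕ.+ e ≤ N → ev N (bern j e) x ≡ x ^ j * (+ 1 - x) ^ e
ev-bern x j zero    {N} j≤N = trans (ev-mono x (subst (_≤ N) (ℕP.+-identityʳ j) j≤N)) (sym (ℤP.*-identityʳ _))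
ev-bern x j (suc e) {N} j+e<N with subst (_≤ N) (ℕP.+-suc j e) j+e<N
... | s≤s {n = N′} j+e≤N′ = begin
  ev N (bern j (suc e)) x
    ≡⟨ IsLinear.sub-homo (ev-linear N x) (bern j e) (mulX (bern j e)) ⟩
  ev N (bern j e) x - ev (suc N′) (mulX (bern j e)) x
    ≡⟨ cong₂ _-_ (ev-bern x j e (ℕP.m≤n⇒m≤1+n j+e≤N′)) (trans (ev-mulX N′ (bern j e) x) (cong (x *_) (ev-bern x j e j+e≤N′))) ⟩
  x ^ j * (+ 1 - x) ^ e - x * (x ^ j * (+ 1 - x) ^ e)
    ≡⟨ factor (x ^ j) ((+ 1 - x) ^ e) x ⟩
  x ^ j * (+ 1 - x) ^ suc e ∎
  where
  open ≡-Reasoning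
  factor : ∀ p q x → p * q - x * (p * q) ≡ p * ((+ 1 - x) * q)
  factor = solve-∀

ev-bernSum : ∀ x n (a : ℕ → ℤ) {N} → n ≤ N → ev N (bernSum n a) x ≡ sum1to n (λ j → a j * x ^ j * (+ 1 - x) ^ (n ∸ j))
ev-bernSum x n a {N} n≤N =
  trans (IsLinear.sum1to-homo (ev-linear N x) n a (λ j → bern j (n ∸ j)))
        (sum1to-cong n (λ j j<n → trans (cong (a (suc j) *_) (ev-bern x (suc j) (n ∸ suc j) (bound j<n)))
                                        (sym (ℤP.*-assoc (a (suc j)) _ _))))
  where
  bound : ∀ {j} → j ≤ n → j ℕ.+ (n ∸ j) ≤ N
  bound j≤n = subst (_≤ N) (sym (ℕP.m+[n∸m]≡n j≤n)) n≤N

peakPoly : ℕ → Poly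
peakPoly m i = sumℤ (map (λ π → mono (suc (pk π)) i) (perms m))

grow-mono : ∀ L k i →
  grow (suc (suc L)) (mono (suc k)) i ≡ mono (suc k) i + slotSum L k (λ t → mono (suc t) i)
grow-mono L k i =
  trans (cong₂ (λ u v → + suc (suc L) * u + v) (mulX-mono (suc k) i) (Θ-mono (suc k) i))
        (regroup (+ L) (+ k) (mono (suc k) i) (mono (suc (suc k)) i))
  where
  regroup : ∀ L k u v → (+ 1 + (+ 1 + L)) * v + + 2 * (+ 1 + k) * (u - v)
                      ≡ u + ((+ 1 + + 2 * k) * u + (L - + 2 * k) * v)
  regroup = solve-∀

peakPoly-grow : ∀ m → 1 ≤ m → peakPoly (suc m) ≗ grow (suc m) (peakPoly m)
peakPoly-grow m 1≤m i = begin
  peakPoly (suc m) i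
    ≡⟨ sumℤ-perms-suc {m} (λ π → mono (suc (pk π)) i) ⟩
  sumℤ (map (λ σ → sumℤ (map (λ π → mono (suc (pk π)) i) (insertMax σ))) (perms m))
    ≡⟨ cong sumℤ (LP.map-cong-local {xs = perms m} (All.tabulate insertMax-grow)) ⟩
  sumℤ (map (λ σ → grow (suc m) (mono (suc (pk σ))) i) (perms m))
    ≡⟨ IsLinear.sumℤ-homo (grow-linear (suc m) i) (λ σ → mono (suc (pk σ))) (perms m) ⟨
  grow (suc m) (peakPoly m) i ∎
  where
  open ≡-Reasoning
  insertMax-grow : ∀ {σ} → σ ∈ perms m →
    sumℤ (map (λ π → mono (suc (pk π)) i) (insertMax σ)) ≡ grow (suc m) (mono (suc (pk σ))) i
  insertMax-grow {[]}    σ∈ = contradiction (subst (1 ≤_) (sym (proj₁ (∈-perms⁻ σ∈))) 1≤m) λ ()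
  insertMax-grow {a ∷ τ} σ∈ = begin
    sumℤ (map (λ π → mono (suc (pk π)) i) (insertMax (a ∷ τ)))
      ≡⟨ pk-insertMax (λ t → mono (suc t) i) a τ ⟩
    mono (suc k) i + slotSum (length τ) k (λ t → mono (suc t) i)
      ≡⟨ grow-mono (length τ) k i ⟨
    grow (suc (length (a ∷ τ))) (mono (suc k)) i
      ≡⟨ cong (λ l → grow (suc l) (mono (suc k)) i) (proj₁ (∈-perms⁻ σ∈)) ⟩
    grow (suc m) (mono (suc k)) i ∎
    where k = pk (a ∷ τ)

pk-∷-≤ : ∀ {n} (a : Fin n) τ → pk (a ∷ τ) ≤ length τ
pk-∷-≤ a []          = z≤n
pk-∷-≤ a (b ∷ [])    = z≤n
pk-∷-≤ a (b ∷ c ∷ τ) = ℕP.+-mono-≤ (indicator≤1 _) (pk-∷-≤ b (c ∷ τ))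
  where
  indicator≤1 : ∀ e → ind e ≤ 1
  indicator≤1 true  = s≤s z≤n
  indicator≤1 false = z≤n

ev-peakPoly : ∀ m → 1 ≤ m → ∀ x → ev m (peakPoly m) x ≡ x * P m x
ev-peakPoly m 1≤m x = begin
  ev m (peakPoly m) x
    ≡⟨ IsLinear.sumℤ-homo (ev-linear m x) (λ π → mono (suc (pk π))) (perms m) ⟩
  sumℤ (map (λ π → ev m (mono (suc (pk π))) x) (perms m))
    ≡⟨ cong sumℤ (LP.map-cong-local {xs = perms m} (All.tabulate (ev-mono x ∘ degree≤))) ⟩
  sumℤ (map (λ π → x * x ^ pk π) (perms m))
    ≡⟨ sumℤ-map-* x (λ π → x ^ pk π) (perms m) ⟩
  x * P m x ∎
  where
  open ≡-Reasoning
  degree≤ : ∀ {π} → π ∈ perms m → suc (pk π) ≤ m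
  degree≤ {[]}    π∈ = contradiction (subst (1 ≤_) (sym (proj₁ (∈-perms⁻ π∈))) 1≤m) λ ()
  degree≤ {a ∷ τ} π∈ = subst (suc (pk (a ∷ τ)) ≤_) (proj₁ (∈-perms⁻ π∈)) (s≤s (pk-∷-≤ a τ))

U-zeroʳ : ∀ n → U n 0 ≡ 0
U-zeroʳ zero          = refl
U-zeroʳ (suc zero)    = refl
U-zeroʳ (suc (suc n)) = refl

U-vanish : ∀ {n j} → n < j → U n j ≡ 0
U-vanish {zero}                   _         = refl
U-vanish {suc zero}    {suc zero} (s≤s ())
U-vanish {suc zero}    {suc (suc j)} _      = refl
U-vanish {suc (suc n)} {suc j}    (s≤s n<j) =
  trans (cong₂ (λ u v → u ℕ.+ suc j ℕ.* suc j ℕ.* v) (U-vanish n<j) (U-vanish (ℕP.m<n⇒m<1+n n<j)))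
        (ℕP.*-zeroʳ (suc j ℕ.* suc j))

oddCoeff evenCoeff : ℕ → ℕ → ℕ
oddCoeff  n j = 2 ℕ.^ (2 ℕ.* n ∸ 2 ℕ.* j) ℕ.* ((2 ℕ.* j ∸ 1) !) ℕ.* U n j
evenCoeff n j = 2 ℕ.^ (2 ℕ.* n ∸ 2 ℕ.* j) ℕ.* ((2 ℕ.* j) !) ℕ.* U n j

evenCoeff-oddCoeff : ∀ n j → evenCoeff n j ≡ 2 ℕ.* j ℕ.* oddCoeff n j
evenCoeff-oddCoeff n zero    = trans (cong (2 ℕ.^ (2 ℕ.* n) ℕ.* 1 ℕ.*_) (U-zeroʳ n)) (ℕP.*-zeroʳ (2 ℕ.^ (2 ℕ.* n) ℕ.* 1))
evenCoeff-oddCoeff n (suc j) = regroup (2 ℕ.^ (2 ℕ.* n ∸ 2 ℕ.* suc j)) (2 ℕ.* suc j ∸ 1) ((2 ℕ.* suc j ∸ 1) !) (U n (suc j))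
  where
  regroup : ∀ t s f u → t ℕ.* (suc s ℕ.* f) ℕ.* u ≡ suc s ℕ.* (t ℕ.* f ℕ.* u)
  regroup = ℕ-Solver.solve-∀

pow-split : ∀ {j n} → suc j ≤ n → 2 ℕ.^ (2 ℕ.* n ∸ 2 ℕ.* j) ≡ 4 ℕ.* 2 ℕ.^ (2 ℕ.* n ∸ 2 ℕ.* suc j)
pow-split {j} {n} sj≤n = begin
  2 ℕ.^ (2 ℕ.* n ∸ 2 ℕ.* j)             ≡⟨ cong (2 ℕ.^_) (ℕP.*-distribˡ-∸ 2 n j) ⟨
  2 ℕ.^ (2 ℕ.* (n ∸ j))                 ≡⟨ cong (λ t → 2 ℕ.^ (2 ℕ.* t)) (ℕP.+-∸-assoc 1 sj≤n) ⟩
  2 ℕ.^ (2 ℕ.* suc (n ∸ suc j))         ≡⟨ cong (2 ℕ.^_) (ℕP.*-suc 2 (n ∸ suc j)) ⟩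
  2 ℕ.* (2 ℕ.* 2 ℕ.^ (2 ℕ.* (n ∸ suc j))) ≡⟨ ℕP.*-assoc 2 2 (2 ℕ.^ (2 ℕ.* (n ∸ suc j))) ⟨
  4 ℕ.* 2 ℕ.^ (2 ℕ.* (n ∸ suc j))       ≡⟨ cong (λ t → 4 ℕ.* 2 ℕ.^ t) (ℕP.*-distribˡ-∸ 2 n (suc j)) ⟩
  4 ℕ.* 2 ℕ.^ (2 ℕ.* n ∸ 2 ℕ.* suc j)   ∎
  where open ≡-Reasoning

oddCoeff-suc : ∀ n j → 1 ≤ n →
  oddCoeff (suc n) (suc j) ≡ 2 ℕ.* suc j ℕ.* evenCoeff n (suc j) ℕ.+ suc (2 ℕ.* j) ℕ.* evenCoeff n j
oddCoeff-suc n@(suc _) j _ = begin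
  oddCoeff (suc n) (suc j)
    ≡⟨ cong₂ (λ e f → 2 ℕ.^ e ℕ.* f ℕ.* U (suc n) (suc j)) (cong₂ _∸_ (ℕP.*-suc 2 n) (ℕP.*-suc 2 j))
                                                         (cong (λ t → (t ∸ 1) !) (ℕP.*-suc 2 j)) ⟩
  2 ℕ.^ (2 ℕ.* n ∸ 2 ℕ.* j) ℕ.* (o ℕ.* F) ℕ.* (U n j ℕ.+ suc j ℕ.* suc j ℕ.* U n (suc j))
    ≡⟨ U-recurrence-step ⟩
  2 ℕ.* suc j ℕ.* (T ℕ.* (suc o ℕ.* (o ℕ.* F)) ℕ.* U n (suc j)) ℕ.+ o ℕ.* evenCoeff n j
    ≡⟨ cong (λ f → 2 ℕ.* suc j ℕ.* (T ℕ.* f ℕ.* U n (suc j)) ℕ.+ o ℕ.* evenCoeff n j) (cong _! (ℕP.*-suc 2 j)) ⟨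
  2 ℕ.* suc j ℕ.* evenCoeff n (suc j) ℕ.+ o ℕ.* evenCoeff n j ∎
  where
  open ≡-Reasoning
  o = suc (2 ℕ.* j)
  F = (2 ℕ.* j) !
  T = 2 ℕ.^ (2 ℕ.* n ∸ 2 ℕ.* suc j)
  P′ = 2 ℕ.^ (2 ℕ.* n ∸ 2 ℕ.* j)
  U-recurrence-step : P′ ℕ.* (o ℕ.* F) ℕ.* (U n j ℕ.+ suc j ℕ.* suc j ℕ.* U n (suc j))
                    ≡ 2 ℕ.* suc j ℕ.* (T ℕ.* (suc o ℕ.* (o ℕ.* F)) ℕ.* U n (suc j)) ℕ.+ o ℕ.* evenCoeff n j
  U-recurrence-step with ℕP.≤-<-connex (suc j) n
  ... | inj₁ sj≤n = begin
    P′ ℕ.* (o ℕ.* F) ℕ.* (U n j ℕ.+ suc j ℕ.* suc j ℕ.* U n (suc j))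
      ≡⟨ cong (λ p → p ℕ.* (o ℕ.* F) ℕ.* (U n j ℕ.+ suc j ℕ.* suc j ℕ.* U n (suc j))) (pow-split sj≤n) ⟩
    4 ℕ.* T ℕ.* (o ℕ.* F) ℕ.* (U n j ℕ.+ suc j ℕ.* suc j ℕ.* U n (suc j))
      ≡⟨ regroup T F (U n j) (U n (suc j)) j ⟩
    2 ℕ.* suc j ℕ.* (T ℕ.* (suc o ℕ.* (o ℕ.* F)) ℕ.* U n (suc j)) ℕ.+ o ℕ.* (4 ℕ.* T ℕ.* F ℕ.* U n j)
      ≡⟨ cong (λ p → 2 ℕ.* suc j ℕ.* (T ℕ.* (suc o ℕ.* (o ℕ.* F)) ℕ.* U n (suc j)) ℕ.+ o ℕ.* (p ℕ.* F ℕ.* U n j)) (pow-split sj≤n) ⟨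
    2 ℕ.* suc j ℕ.* (T ℕ.* (suc o ℕ.* (o ℕ.* F)) ℕ.* U n (suc j)) ℕ.+ o ℕ.* evenCoeff n j ∎
    where
    regroup : ∀ t f u₀ u₁ j → 4 ℕ.* t ℕ.* (suc (2 ℕ.* j) ℕ.* f) ℕ.* (u₀ ℕ.+ suc j ℕ.* suc j ℕ.* u₁)
            ≡ 2 ℕ.* suc j ℕ.* (t ℕ.* (suc (suc (2 ℕ.* j)) ℕ.* (suc (2 ℕ.* j) ℕ.* f)) ℕ.* u₁) ℕ.+ suc (2 ℕ.* j) ℕ.* (4 ℕ.* t ℕ.* f ℕ.* u₀)
    regroup = ℕ-Solver.solve-∀
  ... | inj₂ n<sj rewrite U-vanish n<sj = vanish P′ o F (U n j) (suc j) (T ℕ.* (suc o ℕ.* (o ℕ.* F)))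
    where
    vanish : ∀ p o f u₀ s x → p ℕ.* (o ℕ.* f) ℕ.* (u₀ ℕ.+ s ℕ.* s ℕ.* 0) ≡ 2 ℕ.* s ℕ.* (x ℕ.* 0) ℕ.+ o ℕ.* (p ℕ.* f ℕ.* u₀)
    vanish = ℕ-Solver.solve-∀

evenCoeff-beyond : ∀ n → evenCoeff n (suc n) ≡ 0
evenCoeff-beyond n = trans (cong (2 ℕ.^ (2 ℕ.* n ∸ 2 ℕ.* suc n) ℕ.* (2 ℕ.* suc n) ! ℕ.*_) (U-vanish (ℕP.n<1+n n)))
                           (ℕP.*-zeroʳ (2 ℕ.^ (2 ℕ.* n ∸ 2 ℕ.* suc n) ℕ.* (2 ℕ.* suc n) !))

pos-*-* : ∀ a b c → + (a ℕ.* b ℕ.* c) ≡ + a * + b * + c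
pos-*-* a b c = trans (ℤP.pos-* (a ℕ.* b) c) (cong (_* + c) (ℤP.pos-* a b))

evenCoeff-oddCoeffℤ : ∀ n j → + evenCoeff n j ≡ + 2 * + j * + oddCoeff n j
evenCoeff-oddCoeffℤ n j = trans (cong +_ (evenCoeff-oddCoeff n j)) (pos-*-* 2 j (oddCoeff n j))

oddCoeff-sucℤ : ∀ n → 1 ≤ n → ∀ j → + oddCoeff (suc n) (suc j) ≡ oddNext (λ j → + evenCoeff n j) (suc j)
oddCoeff-sucℤ n 1≤n j = trans (cong +_ (oddCoeff-suc n j 1≤n))
  (cong₂ _+_ (pos-*-* 2 (suc j) (evenCoeff n (suc j)))
             (trans (ℤP.pos-* (suc (2 ℕ.* j)) (evenCoeff n j)) (cong (λ t → (+ 1 + t) * + evenCoeff n j) (ℤP.pos-* 2 j))))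

mutual
  peakPoly-odd : ∀ n → peakPoly (suc (2 ℕ.* n)) ≗ bernSum (suc n) (λ j → + oddCoeff (suc n) j)
  peakPoly-odd zero    i = single (mono 1 i)
    where
    single : ∀ u → u + + 0 ≡ + 0 + + 1 * u
    single = solve-∀
  peakPoly-odd (suc n) i = begin
    peakPoly (suc (2 ℕ.* suc n)) i
      ≡⟨ peakPoly-grow (2 ℕ.* suc n) (s≤s z≤n) i ⟩
    grow (suc (2 ℕ.* suc n)) (peakPoly (2 ℕ.* suc n)) i
      ≡⟨ IsLinear.cong-≗ (grow-linear (suc (2 ℕ.* suc n)) i) (peakPoly-even n) ⟩
    grow (suc (2 ℕ.* suc n)) (bernSum (suc n) (λ j → + evenCoeff (suc n) j)) i
      ≡⟨ grow-bernSum-odd (suc n) (λ j → + evenCoeff (suc n) j) (cong +_ (evenCoeff-oddCoeff (suc n) 0))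
                          (cong +_ (evenCoeff-beyond (suc n))) i ⟩
    bernSum (suc (suc n)) (oddNext (λ j → + evenCoeff (suc n) j)) i
      ≡⟨ sum1to-cong (suc (suc n)) (λ j _ → cong (_* bern (suc j) (suc n ∸ j) i) (oddCoeff-sucℤ (suc n) (s≤s z≤n) j)) ⟨
    bernSum (suc (suc n)) (λ j → + oddCoeff (suc (suc n)) j) i ∎
    where open ≡-Reasoning

  peakPoly-even : ∀ n → peakPoly (2 ℕ.* suc n) ≗ bernSum (suc n) (λ j → + evenCoeff (suc n) j)
  peakPoly-even n i = begin
    peakPoly (2 ℕ.* suc n) i
      ≡⟨ cong (λ m → peakPoly m i) (ℕP.*-suc 2 n) ⟩
    peakPoly (suc (suc (2 ℕ.* n))) i
      ≡⟨ peakPoly-grow (suc (2 ℕ.* n)) (s≤s z≤n) i ⟩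
    grow (suc (suc (2 ℕ.* n))) (peakPoly (suc (2 ℕ.* n))) i
      ≡⟨ IsLinear.cong-≗ (grow-linear (suc (suc (2 ℕ.* n))) i) (peakPoly-odd n) ⟩
    grow (suc (suc (2 ℕ.* n))) (bernSum (suc n) (λ j → + oddCoeff (suc n) j)) i
      ≡⟨ cong (λ L → grow L (bernSum (suc n) (λ j → + oddCoeff (suc n) j)) i) (ℕP.*-suc 2 n) ⟨
    grow (2 ℕ.* suc n) (bernSum (suc n) (λ j → + oddCoeff (suc n) j)) i
      ≡⟨ grow-bernSum-even (suc n) (λ j → + oddCoeff (suc n) j) i ⟩
    bernSum (suc n) (λ j → + 2 * + j * + oddCoeff (suc n) j) i
      ≡⟨ sum1to-cong (suc n) (λ j _ → cong (_* bern (suc j) (n ∸ j) i) (evenCoeff-oddCoeffℤ (suc n) (suc j))) ⟨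
    bernSum (suc n) (λ j → + evenCoeff (suc n) j) i ∎
    where open ≡-Reasoning

xP-odd : ∀ n x → x * P (suc (2 ℕ.* n)) x ≡ sum1to (suc n) (λ j → + oddCoeff (suc n) j * x ^ j * (+ 1 - x) ^ (suc n ∸ j))
xP-odd n x = begin
  x * P (suc (2 ℕ.* n)) x                                    ≡⟨ ev-peakPoly (suc (2 ℕ.* n)) (s≤s z≤n) x ⟨
  ev (suc (2 ℕ.* n)) (peakPoly (suc (2 ℕ.* n))) x             ≡⟨ IsLinear.cong-≗ (ev-linear (suc (2 ℕ.* n)) x) (peakPoly-odd n) ⟩
  ev (suc (2 ℕ.* n)) (bernSum (suc n) (λ j → + oddCoeff (suc n) j)) x
    ≡⟨ ev-bernSum x (suc n) (λ j → + oddCoeff (suc n) j) (s≤s (ℕP.m≤m+n n (n ℕ.+ 0))) ⟩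
  sum1to (suc n) (λ j → + oddCoeff (suc n) j * x ^ j * (+ 1 - x) ^ (suc n ∸ j)) ∎
  where open ≡-Reasoning

xP-even : ∀ n x → x * P (2 ℕ.* suc n) x ≡ sum1to (suc n) (λ j → + evenCoeff (suc n) j * x ^ j * (+ 1 - x) ^ (suc n ∸ j))
xP-even n x = begin
  x * P (2 ℕ.* suc n) x                                      ≡⟨ ev-peakPoly (2 ℕ.* suc n) (s≤s z≤n) x ⟨
  ev (2 ℕ.* suc n) (peakPoly (2 ℕ.* suc n)) x                 ≡⟨ IsLinear.cong-≗ (ev-linear (2 ℕ.* suc n) x) (peakPoly-even n) ⟩
  ev (2 ℕ.* suc n) (bernSum (suc n) (λ j → + evenCoeff (suc n) j)) x
    ≡⟨ ev-bernSum x (suc n) (λ j → + evenCoeff (suc n) j) (ℕP.m≤m+n (suc n) (suc n ℕ.+ 0)) ⟩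
  sum1to (suc n) (λ j → + evenCoeff (suc n) j * x ^ j * (+ 1 - x) ^ (suc n ∸ j)) ∎
  where open ≡-Reasoning

corollary3 : (n : ℕ) → 1 ≤ n → (x : ℤ) →
    (x * P (2 ℕ.* n ∸ 1) x
      ≡ sum1to n (λ j → + (2 ℕ.^ (2 ℕ.* n ∸ 2 ℕ.* j) ℕ.* ((2 ℕ.* j ∸ 1) !) ℕ.* U n j) * (x ^ j) * ((+ 1 - x) ^ (n ∸ j))))
    × (x * P (2 ℕ.* n) x
      ≡ sum1to n (λ j → + (2 ℕ.^ (2 ℕ.* n ∸ 2 ℕ.* j) ℕ.* ((2 ℕ.* j) !) ℕ.* U n j) * (x ^ j) * ((+ 1 - x) ^ (n ∸ j))))
corollary3 (suc n) _ x = trans (cong (λ m → x * P m x) odd-index) (xP-odd n x) , xP-even n x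
  where
  odd-index : 2 ℕ.* suc n ∸ 1 ≡ suc (2 ℕ.* n)
  odd-index = cong (_∸ 1) (ℕP.*-suc 2 n)
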